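{- Let $G$ be a simple planar triangulation on $n$ vertices. Then every independent set $I$ of $G$ all of whose vertices have degree at least six in $G$ satisfies $|I| \leq (n-2)/3$.
   Context: A triangulation is a simple plane graph in which every face, including the outer face, is bounded by a cycle of length three. -}

module Defs where

open import Data.Nat using (ℕ; zero; suc; _+_; _*_; _≤_)
open import Data.Fin using (Fin)
open import Data.Fin.Permutation using (Permutation′; _⟨$⟩ʳ_)
open import Data.Product using (Σ; ∃; ∃-syntax; _×_; _,_)
open import Data.List using (List; length)
open import Data.List.Membership.Propositional using (_∈_)
open import Data.List.Relation.Unary.Unique.Propositional using (Unique)
open import Function using (_∘_; Injective)
open import Function.Bundles using (_⇔_)
open import Relation.Binary.PropositionalEquality using (_≡_; _≢_)
open import Relation.Nullary using (¬_)

iter : {A : Set} → (A → A) → ℕ → A → A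
iter f zero    x = x
iter f (suc k) x = f (iter f k x)

SameOrbit : {A : Set} → (A → A) → A → A → Set
SameOrbit f d d' = ∃[ k ] iter f k d ≡ d'

data Reach {D : ℕ} (σ α : Fin D → Fin D) : Fin D → Fin D → Set where
  here  : ∀ {d} → Reach σ α d d
  viaσ  : ∀ {d d'} → Reach σ α (σ d) d' → Reach σ α d d'
  viaα  : ∀ {d d'} → Reach σ α (α d) d' → Reach σ α d d'

-- A simple plane triangulation with vertex set Fin n, given as a
-- combinatorial map (rotation system) of genus 0:
--  * darts Fin (m + m), m = number of edges;
--  * α : fixed-point-free involution pairing the two darts of an edge;
--  * σ : rotation (cyclic order of darts around each vertex);
--  * faces are the orbits of φ = σ ∘ α;
--  * vertices (Fin n) and faces (Fin f) are exactly the σ-/φ-orbits;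
--  * the map is connected and satisfies Euler's formula n - m + f = 2,
--    i.e. it is a cellular embedding in the sphere;
--  * every face is bounded by a closed walk of length exactly 3;
--  * the underlying graph is simple (no loops, no parallel edges).
record PlaneTriangulation (n : ℕ) : Set where
  field
    m f : ℕ
    σ α : Permutation′ (m + m)
  σf : Fin (m + m) → Fin (m + m)
  σf d = σ ⟨$⟩ʳ d
  αf : Fin (m + m) → Fin (m + m)
  αf d = α ⟨$⟩ʳ d
  φ : Fin (m + m) → Fin (m + m)
  φ = σf ∘ αf
  field
    α-invol    : ∀ d → αf (αf d) ≡ d
    α-fpf      : ∀ d → αf d ≢ d
    vert       : Fin (m + m) → Fin n
    vert-surj  : ∀ v → ∃[ d ] vert d ≡ v
    vert-orbit : ∀ d d' → (vert d ≡ vert d') ⇔ SameOrbit σf d d'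
    face       : Fin (m + m) → Fin f
    face-surj  : ∀ x → ∃[ d ] face d ≡ x
    face-orbit : ∀ d d' → (face d ≡ face d') ⇔ SameOrbit φ d d'
    connected  : ∀ d d' → Reach σf αf d d'
    euler      : n + f ≡ m + 2
    tri-3      : ∀ d → φ (φ (φ d)) ≡ d
    tri-not1   : ∀ d → φ d ≢ d
    loopless   : ∀ d → vert d ≢ vert (αf d)
    no-multi   : ∀ d d' → vert d ≡ vert d' → vert (αf d) ≡ vert (αf d') → d ≡ d'

  Adj : Fin n → Fin n → Set
  Adj u w = ∃[ d ] (vert d ≡ u × vert (αf d) ≡ w)

  DegAtLeast : ℕ → Fin n → Set
  DegAtLeast k v = Σ (Fin k → Fin n) λ g → Injective _≡_ _≡_ g × (∀ i → Adj v (g i))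

  Independent : List (Fin n) → Set
  Independent I = Unique I × (∀ {u w} → u ∈ I → w ∈ I → ¬ Adj u w)

{-# OPTIONS --safe #-}

-- Every face is a triangle, so two distinct darts on a common face start at adjacent
-- vertices. Hence the six darts leaving a vertex of the independent set I towards distinct
-- neighbours lie on six distinct faces, and no face is met by two vertices of I: 6|I| ≤ f.
-- Each face has three distinct darts, so 3f ≤ 2m, and with Euler's formula n + f = m + 2
-- this gives f ≤ 2n − 4.
module Submission where

open import Defs
open import Data.Nat using (ℕ; zero; suc; _+_; _*_; _≤_)
open import Data.Nat.Properties using (*-cancelˡ-≤; +-cancelʳ-≤; +-monoˡ-≤; module ≤-Reasoning)
open import Data.Nat.Tactic.RingSolver using (solve-∀)
open import Data.Fin using (Fin; zero; suc; toℕ; remQuot; combine)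
open import Data.Fin.Properties using (injective⇒≤; combine-remQuot)
open import Data.List using (List; length; lookup; _∷_)
open import Data.List.Membership.Propositional using (_∈_)
open import Data.List.Membership.Propositional.Properties using (∈-lookup)
open import Data.List.Relation.Unary.Unique.Propositional using (Unique)
open import Data.List.Relation.Unary.AllPairs using (_∷_)
import Data.List.Relation.Unary.All as All
open import Data.Product using (Σ; ∃-syntax; _×_; _,_; proj₁; proj₂; uncurry)
open import Data.Product.Properties using (×-≡,≡→≡)
open import Data.Sum using (_⊎_; inj₁; inj₂)
open import Data.Empty using (⊥-elim)
open import Function using (_∘_; Injective)
open import Function.Bundles using (Equivalence)
open import Relation.Binary.PropositionalEquality using (_≡_; _≢_; refl; sym; trans; cong; cong₂; subst; module ≡-Reasoning)

unique⇒lookup-injective : ∀ {A : Set} {xs : List A} → Unique xs → Injective _≡_ _≡_ (lookup xs)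
unique⇒lookup-injective {xs = _ ∷ _} _       {zero}  {zero}  _ = refl
unique⇒lookup-injective {xs = _ ∷ _} (x∉ ∷ _) {zero}  {suc q} e = ⊥-elim (All.lookup x∉ (∈-lookup q) e)
unique⇒lookup-injective {xs = _ ∷ _} (x∉ ∷ _) {suc p} {zero}  e = ⊥-elim (All.lookup x∉ (∈-lookup p) (sym e))
unique⇒lookup-injective {xs = _ ∷ _} (_ ∷ u)  {suc p} {suc q} e = cong suc (unique⇒lookup-injective u e)

injective₂⇒≤ : ∀ {a b c} (g : Fin a → Fin b → Fin c) →
               (∀ {x j y k} → g x j ≡ g y k → x ≡ y × j ≡ k) → a * b ≤ c
injective₂⇒≤ {a} {b} g g-inj = injective⇒≤ injective
  where
    open ≡-Reasoning
    injective : Injective _≡_ _≡_ (uncurry g ∘ remQuot {a} b)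
    injective {z} {z′} e = begin
      z                                  ≡⟨ combine-remQuot {a} b z ⟨
      uncurry combine (remQuot {a} b z)  ≡⟨ cong (uncurry combine) (×-≡,≡→≡ (g-inj e)) ⟩
      uncurry combine (remQuot {a} b z′) ≡⟨ combine-remQuot {a} b z′ ⟩
      z′                                 ∎

module Triangulation {n : ℕ} (G : PlaneTriangulation n) where
  open PlaneTriangulation G
  open Equivalence

  Dart : Set
  Dart = Fin (m + m)

  vert-σ : ∀ d → vert (σf d) ≡ vert d
  vert-σ d = sym (from (vert-orbit d (σf d)) (1 , refl))

  vert-αφ² : ∀ d → vert (αf (φ (φ d))) ≡ vert d
  vert-αφ² d = trans (sym (vert-σ _)) (cong vert (tri-3 d))

  Adj-sym : ∀ {u w} → Adj u w → Adj w u
  Adj-sym (d , refl , refl) = αf d , refl , cong vert (α-invol d)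

  corner : Dart → Fin 3 → Dart
  corner d j = iter φ (toℕ j) d

  face-corner : ∀ d j → face (corner d j) ≡ face d
  face-corner d j = sym (from (face-orbit d (corner d j)) (toℕ j , refl))

  iter-φ≡corner : ∀ k d → ∃[ j ] iter φ k d ≡ corner d j
  iter-φ≡corner zero    d = zero , refl
  iter-φ≡corner (suc k) d with iter-φ≡corner k d
  ... | zero           , e = suc zero , cong φ e
  ... | suc zero       , e = suc (suc zero) , cong φ e
  ... | suc (suc zero) , e = zero , trans (cong φ e) (tri-3 d)

  φ²-fpf : ∀ d → φ (φ d) ≢ d
  φ²-fpf d e = tri-not1 (φ (φ d)) (trans (tri-3 d) (sym e))

  corner-injective : ∀ d → Injective _≡_ _≡_ (corner d)
  corner-injective d {zero}           {zero}           _ = refl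
  corner-injective d {zero}           {suc zero}       e = ⊥-elim (tri-not1 d (sym e))
  corner-injective d {zero}           {suc (suc zero)} e = ⊥-elim (φ²-fpf d (sym e))
  corner-injective d {suc zero}       {zero}           e = ⊥-elim (tri-not1 d e)
  corner-injective d {suc zero}       {suc zero}       _ = refl
  corner-injective d {suc zero}       {suc (suc zero)} e = ⊥-elim (tri-not1 (φ d) (sym e))
  corner-injective d {suc (suc zero)} {zero}           e = ⊥-elim (φ²-fpf d e)
  corner-injective d {suc (suc zero)} {suc zero}       e = ⊥-elim (tri-not1 (φ d) e)
  corner-injective d {suc (suc zero)} {suc (suc zero)} _ = refl

  sameFace⇒≡⊎Adj : ∀ d d′ → face d ≡ face d′ → d ≡ d′ ⊎ Adj (vert d) (vert d′)
  sameFace⇒≡⊎Adj d d′ e with to (face-orbit d d′) e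
  ... | k , refl with iter-φ≡corner k d
  ...   | zero           , e′ = inj₁ (sym e′)
  ...   | suc zero       , e′ = inj₂ (d , refl , trans (sym (vert-σ (αf d))) (cong vert (sym e′)))
  ...   | suc (suc zero) , e′ = inj₂ (Adj-sym (_ , refl , trans (cong (vert ∘ αf) e′) (vert-αφ² d)))

  f*3≤m+m : f * 3 ≤ m + m
  f*3≤m+m = injective₂⇒≤ (corner ∘ rep) injective
    where
      rep : Fin f → Dart
      rep x = proj₁ (face-surj x)

      face-rep : ∀ x j → face (corner (rep x) j) ≡ x
      face-rep x j = trans (face-corner (rep x) j) (proj₂ (face-surj x))

      injective : ∀ {x j y k} → corner (rep x) j ≡ corner (rep y) k → x ≡ y × j ≡ k
      injective {x} {j} {y} {k} e with refl ← trans (sym (face-rep x j)) (trans (cong face e) (face-rep y k))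
        = refl , corner-injective (rep x) e

  f+4≤2*n : f + 4 ≤ 2 * n
  f+4≤2*n = +-cancelʳ-≤ (f + f) (f + 4) (2 * n) (begin
    (f + 4) + (f + f) ≡⟨ lhs f ⟩
    f * 3 + 4         ≤⟨ +-monoˡ-≤ 4 f*3≤m+m ⟩
    (m + m) + 4       ≡⟨ mid m ⟩
    (m + 2) + (m + 2) ≡⟨ cong₂ _+_ euler euler ⟨
    (n + f) + (n + f) ≡⟨ rhs n f ⟩
    2 * n + (f + f)   ∎)
    where
      open ≤-Reasoning
      lhs : ∀ x → (x + 4) + (x + x) ≡ x * 3 + 4
      lhs = solve-∀
      mid : ∀ x → (x + x) + 4 ≡ (x + 2) + (x + 2)
      mid = solve-∀
      rhs : ∀ x y → (x + y) + (x + y) ≡ 2 * x + (y + y)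
      rhs = solve-∀

  DistinctDartsAt : ℕ → Fin n → Set
  DistinctDartsAt k v = Σ (Fin k → Dart) λ h → Injective _≡_ _≡_ h × (∀ i → vert (h i) ≡ v)

  DegAtLeast⇒DistinctDartsAt : ∀ {k v} → DegAtLeast k v → DistinctDartsAt k v
  DegAtLeast⇒DistinctDartsAt {k} (g , g-injective , adj) =
    dart , dart-injective , λ i → proj₁ (proj₂ (adj i))
    where
      dart : Fin k → Dart
      dart i = proj₁ (adj i)

      dart-injective : Injective _≡_ _≡_ dart
      dart-injective {i} {j} e = g-injective
        (trans (sym (proj₂ (proj₂ (adj i)))) (trans (cong (vert ∘ αf) e) (proj₂ (proj₂ (adj j)))))

  module _ {I : List (Fin n)} (ind : Independent I) where

    independent-sameFace⇒≡ : ∀ {d d′} → vert d ∈ I → vert d′ ∈ I → face d ≡ face d′ → d ≡ d′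
    independent-sameFace⇒≡ {d} {d′} d∈I d′∈I e with sameFace⇒≡⊎Adj d d′ e
    ... | inj₁ d≡d′ = d≡d′
    ... | inj₂ adj  = ⊥-elim (proj₂ ind d∈I d′∈I adj)

    independent⇒length*k≤f : ∀ {k} → (∀ {v} → v ∈ I → DegAtLeast k v) → length I * k ≤ f
    independent⇒length*k≤f {k} deg = injective₂⇒≤ (λ p i → face (dart p i)) injective
      where
        darts : ∀ p → DistinctDartsAt k (lookup I p)
        darts p = DegAtLeast⇒DistinctDartsAt (deg (∈-lookup p))

        dart : Fin (length I) → Fin k → Dart
        dart p = proj₁ (darts p)

        vert-dart : ∀ p i → vert (dart p i) ≡ lookup I p
        vert-dart p = proj₂ (proj₂ (darts p))

        vert-dart∈I : ∀ p i → vert (dart p i) ∈ I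
        vert-dart∈I p i = subst (_∈ I) (sym (vert-dart p i)) (∈-lookup p)

        injective : ∀ {p i q j} → face (dart p i) ≡ face (dart q j) → p ≡ q × i ≡ j
        injective {p} {i} {q} {j} e
          with dart-eq ← independent-sameFace⇒≡ (vert-dart∈I p i) (vert-dart∈I q j) e
          with refl ← unique⇒lookup-injective (proj₁ ind)
                        (trans (sym (vert-dart p i)) (trans (cong vert dart-eq) (vert-dart q j)))
          = refl , proj₁ (proj₂ (darts p)) dart-eq

mainTheorem2 : (n : ℕ) (G : PlaneTriangulation n) (I : List (Fin n)) →
    PlaneTriangulation.Independent G I →
    (∀ {v} → v ∈ I → PlaneTriangulation.DegAtLeast G 6 v) →
    3 * length I + 2 ≤ n
mainTheorem2 n G I ind deg = *-cancelˡ-≤ 2 (begin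
  2 * (3 * length I + 2) ≡⟨ double (length I) ⟩
  length I * 6 + 4       ≤⟨ +-monoˡ-≤ 4 (independent⇒length*k≤f ind deg) ⟩
  f + 4                  ≤⟨ f+4≤2*n ⟩
  2 * n                  ∎)
  where
    open PlaneTriangulation G using (f)
    open Triangulation G
    open ≤-Reasoning
    double : ∀ L → 2 * (3 * L + 2) ≡ L * 6 + 4
    double = solve-∀
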